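{- For every integer $n\geq 1$, the number of Fishburn permutations of length $n$ that avoid both classical patterns $321$ and $31452$ equals $\frac{P_n+P_{n-1}+1}{2}$, where $P_n$ denotes the Pell numbers, defined by $P_0=0$, $P_1=1$ and $P_n=2P_{n-1}+P_{n-2}$ for $n\geq 2$.
   Context: A permutation of length $n$ is a rearrangement $\pi=\pi_1\cdots\pi_n$ of $[n]$. A permutation $\pi$ contains a classical pattern $p\in S_k$ if some subsequence of $\pi$ of length $k$ is order-isomorphic to $p$; otherwise it avoids $p$. A Fishburn permutation is a permutation $\pi$ for which there are no indices $i<j$ with $\pi_j<\pi_i<\pi_{i+1}$ and $\pi_i=\pi_j+1$. -}

module Defs where

open import Data.Nat using (ℕ; zero; suc; _+_; _*_)
open import Data.Fin using (Fin; toℕ; _<_)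
open import Data.Fin.Properties using (_<?_; _≟_; all?; any?)
open import Data.Vec using (Vec; []; _∷_; lookup)
open import Data.List using (List; []; _∷_; concatMap; allFin; map; length; filter)
open import Data.List.Membership.Propositional using (_∈_)
open import Data.List.Relation.Unary.Any using (Any)
import Data.List.Relation.Unary.Any.Properties as AnyP
open import Data.Product using (Σ; ∃; _×_; _,_)
open import Relation.Nullary using (¬_; Dec; yes; no)
open import Relation.Nullary.Decidable using (_×-dec_; ¬?; _→-dec_)
open import Relation.Binary.PropositionalEquality using (_≡_)

Word : ℕ → Set
Word n = Vec (Fin n) n

IsPerm : ∀ {n} → Word n → Set
IsPerm {n} π = (i j : Fin n) → lookup π i ≡ lookup π j → i ≡ j

Occurs : ∀ {k n} → Vec (Fin k) k → Vec (Fin n) n → Vec (Fin n) k → Set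
Occurs {k} p π ι =
  ((a b : Fin k) → a < b → lookup ι a < lookup ι b) ×
  ((a b : Fin k) → (lookup p a < lookup p b → lookup π (lookup ι a) < lookup π (lookup ι b))
                 × (lookup π (lookup ι a) < lookup π (lookup ι b) → lookup p a < lookup p b))

Contains : ∀ {k n} → Vec (Fin k) k → Vec (Fin n) n → Set
Contains {k} {n} p π = ∃ λ (ι : Vec (Fin n) k) → Occurs p π ι

Avoids : ∀ {k n} → Vec (Fin k) k → Vec (Fin n) n → Set
Avoids p π = ¬ Contains p π

IsFishburn : ∀ {n} → Word n → Set
IsFishburn {n} π = ¬ (Σ (Fin n) λ i → Σ (Fin n) λ i' → Σ (Fin n) λ j →
  (toℕ i' ≡ suc (toℕ i)) × (i < j) ×
  (lookup π j < lookup π i) × (lookup π i < lookup π i') ×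
  (toℕ (lookup π i) ≡ suc (toℕ (lookup π j))))

-- The patterns 321 and 31452 (values written 0-based).
p321 : Vec (Fin 3) 3
p321 = Fin.suc (Fin.suc Fin.zero) ∷ Fin.suc Fin.zero ∷ Fin.zero ∷ []
  where import Data.Fin as Fin

p31452 : Vec (Fin 5) 5
p31452 = # 2 ∷ # 0 ∷ # 3 ∷ # 4 ∷ # 1 ∷ []
  where open import Data.Fin using (#_)

allVecs : ∀ (n k : ℕ) → List (Vec (Fin n) k)
allVecs n zero = [] ∷ []
allVecs n (suc k) = concatMap (λ x → map (x ∷_) (allVecs n k)) (allFin n)

Good : ∀ {n} → Word n → Set
Good π = IsPerm π × IsFishburn π × Avoids p321 π × Avoids p31452 π

pell : ℕ → ℕ
pell zero = 0
pell (suc zero) = 1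
pell (suc (suc n)) = 2 * pell (suc n) + pell n

-- Deleting the last entry of a permutation of length k + 1 and standardising the rest is a
-- bijection onto pairs (σ, v): σ a permutation of length k and v the value of the new last
-- entry (`extend σ v` raises the values ≥ v of σ by one and appends v).  The extension is
-- Fishburn and avoids 321 and 31452 iff σ is and does and v is an active site: in 1-based
-- terms v ∈ {k + 1, k}, or v = k − 1 when k − 1 is a descent top of σ followed later by k.
-- Indeed, a Fishburn violation through the new entry is an ascent starting at the value v,
-- a 321 through it is an inversion among the values ≥ v, and a 31452 through it needs three
-- values above v.
-- Let a(n), e(n), t(n) count the permutations of the class of length n, those ending in
-- their maximum, and those with three active sites.  The top child of σ has three active
-- sites iff σ does not end in its maximum, the second child never has and the third child
-- always has; hence a(n+1) = 2 a(n) + t(n), e(n+1) = a(n) and t(n+1) + e(n) = a(n) + t(n).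
-- So t(n) + 1 = e(n) = a(n−1), and a(n+1) + 1 = 2 a(n) + a(n−1) is the recurrence satisfied
-- by (P(n) + P(n−1) + 1) / 2.

module Submission where

open import Defs
open import Data.Nat as ℕ using (ℕ; zero; suc; _+_; _*_; z≤n; s≤s)
import Data.Nat.Properties as ℕ
open import Data.Nat.ListAction using (sum)
open import Data.Nat.ListAction.Properties using (sum-++)
open import Data.Nat.Tactic.RingSolver using (solve-∀)
open import Data.Fin
  using (Fin; zero; suc; toℕ; fromℕ; inject₁; lower₁; punchIn; punchOut; fromℕ<; _<_)
open import Data.Fin.Patterns using (0F; 1F; 2F; 3F; 4F)
open import Data.Fin.Properties
  using ( toℕ-injective; toℕ-fromℕ; toℕ-inject₁; toℕ<n; toℕ-fromℕ<
        ; inject₁-injective; inject₁-lower₁; fromℕ≢inject₁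
        ; punchIn-injective; punchInᵢ≢i; punchIn-mono-≤; punchIn-punchOut; punchOut-injective
        ; <⇒notInjective; any? )
import Data.Fin.Properties as Fin
open import Data.Fin.Relation.Unary.Top using (view; ‵fromℕ; ‵inject₁)
open import Data.Vec using (Vec; []; _∷_; lookup; _∷ʳ_; map; tabulate)
open import Data.Vec.Properties
  using (lookup-map; lookup∘tabulate; tabulate∘lookup; tabulate-cong; ∷ʳ-injective)
open import Data.Vec.Relation.Unary.Linked using (Linked; [-]; _∷_)
import Data.Vec.Relation.Unary.Linked.Properties as Linked
open import Data.List as List using (List; []; _∷_; _++_; length; concatMap)
open import Data.List.Properties using (length-++; length-map; map-++)
open import Data.List.Membership.Propositional using (_∈_; find; lose)
open import Data.List.Membership.Propositional.Properties
  using (∈-map⁺; ∈-map⁻; ∈-concatMap⁺; ∈-concatMap⁻)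
open import Data.List.Relation.Unary.Any using (here; there)
open import Data.List.Relation.Unary.All as All using (All; []; _∷_)
open import Data.List.Relation.Unary.AllPairs using ([]; _∷_)
open import Data.List.Relation.Unary.Unique.Propositional using (Unique)
import Data.List.Relation.Unary.Unique.Propositional.Properties as Unique
open import Data.Product using (Σ; ∃; _×_; _,_; proj₁; proj₂)
open import Data.Sum using (_⊎_; inj₁; inj₂)
open import Data.Empty using (⊥; ⊥-elim)
open import Function using (_∘_)
open import Function.Bundles using (_⇔_; mk⇔; Equivalence)
open import Relation.Nullary using (¬_; Dec; yes; no)
open import Relation.Nullary.Decidable using (_×-dec_)
open import Relation.Binary using (tri<; tri≈; tri>)
open import Relation.Binary.PropositionalEquality

lookup-∷ʳ-inject₁ : ∀ {A : Set} {k} (xs : Vec A k) y i →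
                    lookup (xs ∷ʳ y) (inject₁ i) ≡ lookup xs i
lookup-∷ʳ-inject₁ (x ∷ xs) y zero    = refl
lookup-∷ʳ-inject₁ (x ∷ xs) y (suc i) = lookup-∷ʳ-inject₁ xs y i

lookup-∷ʳ-last : ∀ {A : Set} {k} (xs : Vec A k) y → lookup (xs ∷ʳ y) (fromℕ k) ≡ y
lookup-∷ʳ-last []       y = refl
lookup-∷ʳ-last (x ∷ xs) y = lookup-∷ʳ-last xs y

lookup-extensionality : ∀ {A : Set} {k} (xs ys : Vec A k) →
                        (∀ i → lookup xs i ≡ lookup ys i) → xs ≡ ys
lookup-extensionality xs ys eq = begin
  xs                 ≡⟨ tabulate∘lookup xs ⟨
  tabulate (lookup xs) ≡⟨ tabulate-cong eq ⟩
  tabulate (lookup ys) ≡⟨ tabulate∘lookup ys ⟩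
  ys                 ∎
  where open ≡-Reasoning

toℕ-punchIn-< : ∀ {k} (v : Fin (suc k)) (x : Fin k) →
                toℕ x ℕ.< toℕ v → toℕ (punchIn v x) ≡ toℕ x
toℕ-punchIn-< (suc v) zero    _         = refl
toℕ-punchIn-< (suc v) (suc x) (s≤s x<v) = cong suc (toℕ-punchIn-< v x x<v)

toℕ-punchIn-≥ : ∀ {k} (v : Fin (suc k)) (x : Fin k) →
                toℕ v ℕ.≤ toℕ x → toℕ (punchIn v x) ≡ suc (toℕ x)
toℕ-punchIn-≥ zero    x       _         = refl
toℕ-punchIn-≥ (suc v) (suc x) (s≤s v≤x) = cong suc (toℕ-punchIn-≥ v x v≤x)

punchIn-mono-< : ∀ {k} (v : Fin (suc k)) {x y : Fin k} → x < y → punchIn v x < punchIn v y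
punchIn-mono-< v {x} {y} x<y =
  Fin.≤∧≢⇒< (punchIn-mono-≤ v x y (ℕ.<⇒≤ x<y)) (Fin.<⇒≢ x<y ∘ punchIn-injective v x y)

punchIn-cancel-< : ∀ {k} (v : Fin (suc k)) {x y : Fin k} → punchIn v x < punchIn v y → x < y
punchIn-cancel-< v {x} {y} lt = ℕ.≰⇒> (ℕ.<⇒≱ lt ∘ punchIn-mono-≤ v y x)

data PunchInView {k} (v : Fin (suc k)) (x : Fin k) : Set where
  below : toℕ x ℕ.< toℕ v → toℕ (punchIn v x) ≡ toℕ x → PunchInView v x
  above : toℕ v ℕ.≤ toℕ x → toℕ (punchIn v x) ≡ suc (toℕ x) → PunchInView v x

punchIn-view : ∀ {k} (v : Fin (suc k)) (x : Fin k) → PunchInView v x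
punchIn-view v x with toℕ x ℕ.<? toℕ v
... | yes x<v = below x<v (toℕ-punchIn-< v x x<v)
... | no  x≮v = above (ℕ.≮⇒≥ x≮v) (toℕ-punchIn-≥ v x (ℕ.≮⇒≥ x≮v))

toℕ-punchIn-≡suc⁻¹ : ∀ {k} (v : Fin (suc k)) (x : Fin k) {t} → toℕ v ℕ.≤ t →
                     toℕ (punchIn v x) ≡ suc t → toℕ x ≡ t
toℕ-punchIn-≡suc⁻¹ v x v≤t eq with punchIn-view v x
... | below x<v ex =
  ⊥-elim (ℕ.<-irrefl (trans (sym ex) eq) (ℕ.<-≤-trans x<v (ℕ.m≤n⇒m≤1+n v≤t)))
... | above _   ex = ℕ.suc-injective (trans (sym ex) eq)

punchIn-cancel-adjacent : ∀ {k} (v : Fin (suc k)) (a b : Fin k) →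
  toℕ (punchIn v a) ≡ suc (toℕ (punchIn v b)) → toℕ a ≡ suc (toℕ b)
punchIn-cancel-adjacent v a b eq with punchIn-view v a | punchIn-view v b
... | below _   ea | below _   eb = trans (sym ea) (trans eq (cong suc eb))
... | above _   ea | above _   eb = ℕ.suc-injective (trans (sym ea) (trans eq (cong suc eb)))
... | below a<v ea | above v≤b eb =
  ⊥-elim (ℕ.<-asym a<v (ℕ.≤-<-trans v≤b (ℕ.<⇒≤ (ℕ.≤-reflexive (sym a≡b+2)))))
  where
  a≡b+2 : toℕ a ≡ suc (suc (toℕ b))
  a≡b+2 = trans (sym ea) (trans eq (cong suc eb))
... | above v≤a ea | below b<v eb = ⊥-elim (ℕ.<-irrefl (sym a≡b) (ℕ.<-≤-trans b<v v≤a))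
  where
  a≡b : toℕ a ≡ toℕ b
  a≡b = ℕ.suc-injective (trans (sym ea) (trans eq (cong suc eb)))

punchIn-adjacent : ∀ {k} (v : Fin (suc k)) (a b : Fin k) → toℕ a ≡ suc (toℕ b) →
  toℕ (punchIn v a) ≡ suc (toℕ (punchIn v b)) ⊎ toℕ v ≡ toℕ a
punchIn-adjacent v a b eq with punchIn-view v a | punchIn-view v b
... | below _   ea | below _   eb = inj₁ (trans ea (trans eq (cong suc (sym eb))))
... | above _   ea | above _   eb = inj₁ (trans ea (cong suc (trans eq (sym eb))))
... | above v≤a _  | below b<v _  = inj₂ (ℕ.≤-antisym v≤a (subst (ℕ._≤ toℕ v) (sym eq) b<v))
... | below a<v _  | above v≤b _  =
  ⊥-elim (ℕ.<-asym a<v (ℕ.≤-<-trans v≤b (subst (toℕ b ℕ.<_) (sym eq) (ℕ.n<1+n _))))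

inject₁<fromℕ : ∀ {k} (x : Fin k) → inject₁ x < fromℕ k
inject₁<fromℕ {k} x = subst (toℕ (inject₁ x) ℕ.<_) (sym (toℕ-fromℕ k)) (Fin.inject₁ℕ< x)

inject₁-mono-< : ∀ {k} {x y : Fin k} → x < y → inject₁ x < inject₁ y
inject₁-mono-< {x = x} {y} x<y = subst₂ ℕ._<_ (sym (toℕ-inject₁ x)) (sym (toℕ-inject₁ y)) x<y

-- Extending a word by a new last entry

extend : ∀ {k} → Word k → Fin (suc k) → Word (suc k)
extend σ v = map (punchIn v) σ ∷ʳ v

module _ {k} (σ : Word k) (v : Fin (suc k)) where

  lookup-extend-inject₁ : ∀ i → lookup (extend σ v) (inject₁ i) ≡ punchIn v (lookup σ i)
  lookup-extend-inject₁ i =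
    trans (lookup-∷ʳ-inject₁ (map (punchIn v) σ) v i) (lookup-map i (punchIn v) σ)

  lookup-extend-last : lookup (extend σ v) (fromℕ k) ≡ v
  lookup-extend-last = lookup-∷ʳ-last (map (punchIn v) σ) v

  isPerm-extend : IsPerm σ → IsPerm (extend σ v)
  isPerm-extend σ-inj i j eq with view i | view j
  ... | ‵fromℕ | ‵fromℕ = refl
  ... | ‵fromℕ | ‵inject₁ j = ⊥-elim (punchInᵢ≢i v (lookup σ j)
    (trans (sym (lookup-extend-inject₁ j)) (trans (sym eq) lookup-extend-last)))
  ... | ‵inject₁ i | ‵fromℕ = ⊥-elim (punchInᵢ≢i v (lookup σ i)
    (trans (sym (lookup-extend-inject₁ i)) (trans eq lookup-extend-last)))
  ... | ‵inject₁ i | ‵inject₁ j = cong inject₁ (σ-inj i j (punchIn-injective v _ _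
    (trans (sym (lookup-extend-inject₁ i)) (trans eq (lookup-extend-inject₁ j)))))

  isPerm-extend⁻ : IsPerm (extend σ v) → IsPerm σ
  isPerm-extend⁻ π-inj i j eq = inject₁-injective (π-inj (inject₁ i) (inject₁ j)
    (trans (lookup-extend-inject₁ i) (trans (cong (punchIn v) eq) (sym (lookup-extend-inject₁ j)))))

extend-injective : ∀ {k} {σ σ′ : Word k} {v v′} →
                   extend σ v ≡ extend σ′ v′ → σ ≡ σ′ × v ≡ v′
extend-injective {σ = σ} {σ′} {v} eq with ∷ʳ-injective (map (punchIn v) σ) _ eq
... | eq′ , refl = lookup-extensionality σ σ′ (λ i → punchIn-injective v _ _ (begin
  punchIn v (lookup σ i)           ≡⟨ lookup-map i (punchIn v) σ ⟨
  lookup (map (punchIn v) σ) i     ≡⟨ cong (λ w → lookup w i) eq′ ⟩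
  lookup (map (punchIn v) σ′) i    ≡⟨ lookup-map i (punchIn v) σ′ ⟩
  punchIn v (lookup σ′ i)          ∎)) , refl
  where open ≡-Reasoning

extend-surjective : ∀ {k} (π : Word (suc k)) → IsPerm π →
                    ∃ λ σ → extend σ (lookup π (fromℕ k)) ≡ π
extend-surjective {k} π π-inj = σ , lookup-extensionality _ π agree
  where
  v : Fin (suc k)
  v = lookup π (fromℕ k)
  v≢ : ∀ i → v ≢ lookup π (inject₁ i)
  v≢ i eq = fromℕ≢inject₁ (π-inj _ _ eq)
  σ : Word k
  σ = tabulate (λ i → punchOut (v≢ i))
  agree : ∀ i → lookup (extend σ v) i ≡ lookup π i
  agree i with view i
  ... | ‵fromℕ = lookup-extend-last σ v
  ... | ‵inject₁ j = trans (lookup-extend-inject₁ σ v j)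
                      (trans (cong (punchIn v) (lookup∘tabulate _ j)) (punchIn-punchOut (v≢ j)))

isPerm-surjective : ∀ {n} (π : Word n) → IsPerm π → ∀ y → ∃ λ i → lookup π i ≡ y
isPerm-surjective {zero}  π _     ()
isPerm-surjective {suc n} π π-inj y with any? (λ i → lookup π i Fin.≟ y)
... | yes hit = hit
... | no miss = ⊥-elim (<⇒notInjective {f = λ i → punchOut (y≢ i)} (ℕ.n<1+n n)
                  (λ {i} {j} eq → π-inj i j (punchOut-injective (y≢ i) (y≢ j) eq)))
  where y≢ : ∀ i → y ≢ lookup π i
        y≢ i eq = miss (i , sym eq)

-- Pattern occurrences

occurs-by-values : ∀ {K n} (p : Vec (Fin K) K) (π : Word n) (ι : Vec (Fin n) K) (w : Vec ℕ K) →
  Linked _<_ ι → Linked ℕ._<_ w →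
  (∀ a → toℕ (lookup π (lookup ι a)) ≡ lookup w (lookup p a)) → Occurs p π ι
occurs-by-values p π ι w ι-inc w-inc values =
  (λ a b → Linked.lookup⁺ Fin.<-trans ι-inc) , λ a b → preserve a b , reflect a b
  where
  preserve : ∀ a b → lookup p a < lookup p b → lookup π (lookup ι a) < lookup π (lookup ι b)
  preserve a b lt = subst₂ ℕ._<_ (sym (values a)) (sym (values b)) (Linked.lookup⁺ ℕ.<-trans w-inc lt)
  reflect : ∀ a b → lookup π (lookup ι a) < lookup π (lookup ι b) → lookup p a < lookup p b
  reflect a b lt with Fin.<-cmp (lookup p a) (lookup p b)
  ... | tri< pa<pb _ _ = pa<pb
  ... | tri≈ _ pa≡pb _ =
    ⊥-elim (ℕ.<-irrefl (trans (values a) (trans (cong (lookup w) pa≡pb) (sym (values b)))) lt)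
  ... | tri> _ _ pb<pa = ⊥-elim (ℕ.<-asym lt (preserve b a pb<pa))

module _ {K k} (p : Vec (Fin K) K) (σ : Word k) (v : Fin (suc k)) where

  occurs-extend⇔ : ∀ ι ι′ → (∀ a → toℕ (lookup ι′ a) ≡ toℕ (lookup ι a)) →
    (∀ a → lookup (extend σ v) (lookup ι′ a) ≡ punchIn v (lookup σ (lookup ι a))) →
    Occurs p σ ι ⇔ Occurs p (extend σ v) ι′
  occurs-extend⇔ ι ι′ position value = mk⇔ to from
    where
    to : Occurs p σ ι → Occurs p (extend σ v) ι′
    to (increasing , orderIso) =
      (λ a b a<b → subst₂ ℕ._<_ (sym (position a)) (sym (position b)) (increasing a b a<b)) ,
      λ a b → (λ lt → subst₂ _<_ (sym (value a)) (sym (value b))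
                        (punchIn-mono-< v (proj₁ (orderIso a b) lt))) ,
              (λ lt → proj₂ (orderIso a b)
                        (punchIn-cancel-< v (subst₂ _<_ (value a) (value b) lt)))
    from : Occurs p (extend σ v) ι′ → Occurs p σ ι
    from (increasing , orderIso) =
      (λ a b a<b → subst₂ ℕ._<_ (position a) (position b) (increasing a b a<b)) ,
      λ a b → (λ lt → punchIn-cancel-< v (subst₂ _<_ (value a) (value b) (proj₁ (orderIso a b) lt))) ,
              (λ lt → proj₂ (orderIso a b) (subst₂ _<_ (sym (value a)) (sym (value b))
                                              (punchIn-mono-< v lt)))

  avoids-extend⁻ : Avoids p (extend σ v) → Avoids p σ
  avoids-extend⁻ avoid (ι , occ) =
    avoid (map inject₁ ι , Equivalence.to (occurs-extend⇔ ι (map inject₁ ι) position value) occ)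
    where
    position : ∀ a → toℕ (lookup (map inject₁ ι) a) ≡ toℕ (lookup ι a)
    position a = trans (cong toℕ (lookup-map a inject₁ ι)) (toℕ-inject₁ _)
    value : ∀ a → lookup (extend σ v) (lookup (map inject₁ ι) a) ≡ punchIn v (lookup σ (lookup ι a))
    value a = trans (cong (lookup (extend σ v)) (lookup-map a inject₁ ι)) (lookup-extend-inject₁ σ v _)

occurs-extend⁻ : ∀ {K k} (p : Vec (Fin (suc K)) (suc K)) (σ : Word k) (v : Fin (suc k)) ι →
  Occurs p (extend σ v) ι → k ≢ toℕ (lookup ι (fromℕ K)) → Contains p σ
occurs-extend⁻ {K} {k} p σ v ι occ last≢k =
  ι′ , Equivalence.from (occurs-extend⇔ p σ v ι′ ι position value) occ
  where
  ≢k : ∀ a → k ≢ toℕ (lookup ι a)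
  ≢k a with view a
  ... | ‵fromℕ     = last≢k
  ... | ‵inject₁ b = λ k≡ιb → ℕ.<-irrefl (sym k≡ιb)
    (ℕ.<-≤-trans (proj₁ occ _ _ (inject₁<fromℕ b)) (ℕ.≤-pred (toℕ<n _)))
  ι′ : Vec (Fin k) (suc K)
  ι′ = tabulate (λ a → lower₁ (lookup ι a) (≢k a))
  inject₁-ι′ : ∀ a → inject₁ (lookup ι′ a) ≡ lookup ι a
  inject₁-ι′ a = trans (cong inject₁ (lookup∘tabulate (λ b → lower₁ (lookup ι b) (≢k b)) a))
                       (inject₁-lower₁ _ (≢k a))
  position : ∀ a → toℕ (lookup ι a) ≡ toℕ (lookup ι′ a)
  position a = trans (cong toℕ (sym (inject₁-ι′ a))) (toℕ-inject₁ _)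
  value : ∀ a → lookup (extend σ v) (lookup ι a) ≡ punchIn v (lookup σ (lookup ι′ a))
  value a = trans (cong (lookup (extend σ v)) (sym (inject₁-ι′ a))) (lookup-extend-inject₁ σ v _)

-- Active sites

AscentBottom : ∀ {k} → Word k → ℕ → Set
AscentBottom {k} σ t = Σ (Fin k) λ i → Σ (Fin k) λ i′ →
  toℕ (lookup σ i) ≡ t × toℕ i′ ≡ suc (toℕ i) × lookup σ i < lookup σ i′

InversionAbove : ∀ {k} → Word k → ℕ → Set
InversionAbove {k} σ t = Σ (Fin k) λ i → Σ (Fin k) λ j →
  i < j × lookup σ j < lookup σ i × t ℕ.≤ toℕ (lookup σ j)

DescentTopBeforeSucc : ∀ {k} → Word k → ℕ → Set
DescentTopBeforeSucc {k} σ t = Σ (Fin k) λ i → Σ (Fin k) λ i′ → Σ (Fin k) λ j →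
  toℕ (lookup σ i) ≡ t × toℕ (lookup σ j) ≡ suc t × i < j ×
  toℕ i′ ≡ suc (toℕ i) × lookup σ i′ < lookup σ i

-- Values are 0-based, so `top` is the value k + 1 of the 1-based description.
data ActiveSite {k} (σ : Word k) (v : Fin (suc k)) : Set where
  top    : toℕ v ≡ k → ActiveSite σ v
  second : suc (toℕ v) ≡ k → ActiveSite σ v
  third  : suc (suc (toℕ v)) ≡ k → DescentTopBeforeSucc σ (toℕ v) → ActiveSite σ v

module _ {k} {σ : Word k} {v : Fin (suc k)} where

  activeSite-≤ : ActiveSite σ v → k ℕ.≤ suc (suc (toℕ v))
  activeSite-≤ (top v≡k)       = ℕ.≤-trans (ℕ.≤-reflexive (sym v≡k)) (ℕ.m≤n+m _ 2)
  activeSite-≤ (second v+1≡k)  = ℕ.≤-trans (ℕ.≤-reflexive (sym v+1≡k)) (ℕ.n≤1+n _)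
  activeSite-≤ (third v+2≡k _) = ℕ.≤-reflexive (sym v+2≡k)

  activeSite-low : ActiveSite σ v → suc (suc (toℕ v)) ℕ.≤ k → DescentTopBeforeSucc σ (toℕ v)
  activeSite-low (top v≡k)      room = ⊥-elim (ℕ.<-irrefl v≡k (ℕ.≤-trans (ℕ.n≤1+n _) room))
  activeSite-low (second v+1≡k) room = ⊥-elim (ℕ.<-irrefl v+1≡k room)
  activeSite-low (third _ low)  _    = low

position-unique : ∀ {k} (σ : Word k) → IsPerm σ → ∀ {x y t} →
  toℕ (lookup σ x) ≡ t → toℕ (lookup σ y) ≡ t → x ≡ y
position-unique σ σ-inj {x} {y} σx σy = σ-inj x y (toℕ-injective (trans σx (sym σy)))

module _ {k} (σ : Word k) (v : Fin (suc k)) where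
  private
    π : Word (suc k)
    π = extend σ v

  extend-value-last : toℕ (lookup π (fromℕ k)) ≡ toℕ v
  extend-value-last = cong toℕ (lookup-extend-last σ v)

  extend-value-inject₁ : ∀ x → toℕ (lookup π (inject₁ x)) ≡ toℕ (punchIn v (lookup σ x))
  extend-value-inject₁ x = cong toℕ (lookup-extend-inject₁ σ v x)

  extend-value-below : ∀ x → toℕ (lookup σ x) ℕ.< toℕ v →
                       toℕ (lookup π (inject₁ x)) ≡ toℕ (lookup σ x)
  extend-value-below x σx<v = trans (extend-value-inject₁ x) (toℕ-punchIn-< v _ σx<v)

  extend-value-above : ∀ x {t} → toℕ (lookup σ x) ≡ t → toℕ v ℕ.≤ t →
                       toℕ (lookup π (inject₁ x)) ≡ suc t
  extend-value-above x σx≡t v≤t = trans (extend-value-inject₁ x)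
    (trans (toℕ-punchIn-≥ v _ (subst (toℕ v ℕ.≤_) (sym σx≡t) v≤t)) (cong suc σx≡t))

  extend-value-above⁻ : ∀ x → toℕ v ℕ.< toℕ (lookup π (inject₁ x)) → toℕ v ℕ.≤ toℕ (lookup σ x)
  extend-value-above⁻ x v<πx with punchIn-view v (lookup σ x)
  ... | above v≤σx _  = v≤σx
  ... | below σx<v eq =
    ⊥-elim (ℕ.<-asym σx<v (subst (toℕ v ℕ.<_) (trans (extend-value-inject₁ x) eq) v<πx))

  extend-mono-< : ∀ x y → lookup σ x < lookup σ y → lookup π (inject₁ x) < lookup π (inject₁ y)
  extend-mono-< x y lt = subst₂ _<_ (sym (lookup-extend-inject₁ σ v x))
    (sym (lookup-extend-inject₁ σ v y)) (punchIn-mono-< v lt)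

  extend-cancel-< : ∀ x y → lookup π (inject₁ x) < lookup π (inject₁ y) → lookup σ x < lookup σ y
  extend-cancel-< x y lt = punchIn-cancel-< v
    (subst₂ _<_ (lookup-extend-inject₁ σ v x) (lookup-extend-inject₁ σ v y) lt)

  ascentBottom⇒¬isFishburn : AscentBottom σ (toℕ v) → ¬ IsFishburn π
  ascentBottom⇒¬isFishburn (i , i′ , σi≡v , i′≡i+1 , ascent) fishburn = fishburn
    ( inject₁ i , inject₁ i′ , fromℕ k
    , trans (toℕ-inject₁ i′) (trans i′≡i+1 (cong suc (sym (toℕ-inject₁ i))))
    , inject₁<fromℕ i
    , subst₂ ℕ._<_ (sym extend-value-last) (sym πi≡v+1) (ℕ.n<1+n _)
    , extend-mono-< i i′ ascent
    , trans πi≡v+1 (cong suc (sym extend-value-last)) )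
    where
    πi≡v+1 : toℕ (lookup π (inject₁ i)) ≡ suc (toℕ v)
    πi≡v+1 = extend-value-above i σi≡v ℕ.≤-refl

  isFishburn-extend⁻ : IsFishburn π → IsFishburn σ
  isFishburn-extend⁻ fishburn (a , a′ , c , a′≡a+1 , a<c , σc<σa , σa<σa′ , σa≡σc+1)
    with punchIn-adjacent v (lookup σ a) (lookup σ c) σa≡σc+1
  ... | inj₂ v≡σa = ascentBottom⇒¬isFishburn (a , a′ , sym v≡σa , a′≡a+1 , σa<σa′) fishburn
  ... | inj₁ πa≡πc+1 = fishburn
    ( inject₁ a , inject₁ a′ , inject₁ c
    , trans (toℕ-inject₁ a′) (trans a′≡a+1 (cong suc (sym (toℕ-inject₁ a))))
    , inject₁-mono-< a<c
    , extend-mono-< c a σc<σa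
    , extend-mono-< a a′ σa<σa′
    , trans (extend-value-inject₁ a) (trans πa≡πc+1 (cong suc (sym (extend-value-inject₁ c)))) )

  isFishburn-extend : IsFishburn σ → ¬ AscentBottom σ (toℕ v) → IsFishburn π
  isFishburn-extend fishburn noAscent (i , i′ , j , i′≡i+1 , i<j , πj<πi , πi<πi′ , πi≡πj+1)
    with view i | view i′ | view j
  ... | ‵fromℕ | _ | _ =
    ℕ.<-irrefl (toℕ-fromℕ k) (ℕ.≤-pred (subst (ℕ._< suc k) i′≡i+1 (toℕ<n i′)))
  ... | ‵inject₁ a | ‵fromℕ | ‵fromℕ = ℕ.<-asym πj<πi πi<πi′
  ... | ‵inject₁ a | ‵fromℕ | ‵inject₁ c =
    ℕ.<-irrefl refl (ℕ.<-≤-trans i<j (ℕ.≤-pred (begin-strict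
      toℕ (inject₁ c)       <⟨ Fin.inject₁ℕ< c ⟩
      k                     ≡⟨ toℕ-fromℕ k ⟨
      toℕ (fromℕ k)         ≡⟨ i′≡i+1 ⟩
      suc (toℕ (inject₁ a)) ∎)))
    where open ℕ.≤-Reasoning
  ... | ‵inject₁ a | ‵inject₁ a′ | ‵fromℕ = noAscent
    ( a , a′
    , toℕ-punchIn-≡suc⁻¹ v _ ℕ.≤-refl
        (trans (sym (extend-value-inject₁ a)) (trans πi≡πj+1 (cong suc extend-value-last)))
    , trans (sym (toℕ-inject₁ a′)) (trans i′≡i+1 (cong suc (toℕ-inject₁ a)))
    , extend-cancel-< a a′ πi<πi′ )
  ... | ‵inject₁ a | ‵inject₁ a′ | ‵inject₁ c = fishburn
    ( a , a′ , c
    , trans (sym (toℕ-inject₁ a′)) (trans i′≡i+1 (cong suc (toℕ-inject₁ a)))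
    , subst₂ ℕ._<_ (toℕ-inject₁ a) (toℕ-inject₁ c) i<j
    , extend-cancel-< c a πj<πi
    , extend-cancel-< a a′ πi<πi′
    , punchIn-cancel-adjacent v _ _ (trans (sym (extend-value-inject₁ a))
        (trans πi≡πj+1 (cong suc (extend-value-inject₁ c)))) )

  inversionAbove⇒contains321 : InversionAbove σ (toℕ v) → Contains p321 π
  inversionAbove⇒contains321 (i , j , i<j , σj<σi , v≤σj) =
    ι , occurs-by-values p321 π ι w (inject₁-mono-< i<j ∷ inject₁<fromℕ j ∷ [-])
          (s≤s v≤σj ∷ s≤s σj<σi ∷ [-]) values
    where
    ι : Vec (Fin (suc k)) 3
    ι = inject₁ i ∷ inject₁ j ∷ fromℕ k ∷ []
    w : Vec ℕ 3
    w = toℕ v ∷ suc (toℕ (lookup σ j)) ∷ suc (toℕ (lookup σ i)) ∷ []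
    values : ∀ a → toℕ (lookup π (lookup ι a)) ≡ lookup w (lookup p321 a)
    values 0F = extend-value-above i refl (ℕ.≤-trans v≤σj (ℕ.<⇒≤ σj<σi))
    values 1F = extend-value-above j refl v≤σj
    values 2F = extend-value-last

  avoids321-extend : Avoids p321 σ → ¬ InversionAbove σ (toℕ v) → Avoids p321 π
  avoids321-extend avoid noInversion (i₀ ∷ i₁ ∷ i₂ ∷ [] , occ@(increasing , orderIso))
    with view i₀ | view i₁ | view i₂
  ... | _ | _ | ‵inject₁ x₂ =
    avoid (occurs-extend⁻ p321 σ v (i₀ ∷ i₁ ∷ inject₁ x₂ ∷ []) occ (Fin.toℕ-inject₁-≢ x₂))
  ... | ‵fromℕ | _ | ‵fromℕ = ℕ.<-irrefl refl (increasing 0F 2F (s≤s z≤n))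
  ... | _ | ‵fromℕ | ‵fromℕ = ℕ.<-irrefl refl (increasing 1F 2F ℕ.≤-refl)
  ... | ‵inject₁ x₀ | ‵inject₁ x₁ | ‵fromℕ = noInversion
    ( x₀ , x₁
    , subst₂ ℕ._<_ (toℕ-inject₁ x₀) (toℕ-inject₁ x₁) (increasing 0F 1F ℕ.≤-refl)
    , extend-cancel-< x₁ x₀ (proj₁ (orderIso 1F 0F) ℕ.≤-refl)
    , extend-value-above⁻ x₁ (subst (ℕ._< toℕ (lookup π (inject₁ x₁))) extend-value-last
                               (proj₁ (orderIso 2F 1F) ℕ.≤-refl)) )

  contains31452 : ∀ {y₁ y₁′ y₂ y₃} → y₁ < y₁′ → y₁′ < y₂ → y₂ < y₃ →
    toℕ (lookup σ y₁′) ℕ.< toℕ v → toℕ v ℕ.≤ toℕ (lookup σ y₁) →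
    lookup σ y₁ < lookup σ y₂ → lookup σ y₂ < lookup σ y₃ → Contains p31452 π
  contains31452 {y₁} {y₁′} {y₂} {y₃} y₁<y₁′ y₁′<y₂ y₂<y₃ σy₁′<v v≤σy₁ σy₁<σy₂ σy₂<σy₃ =
    ι , occurs-by-values p31452 π ι w
          ( inject₁-mono-< y₁<y₁′ ∷ inject₁-mono-< y₁′<y₂ ∷ inject₁-mono-< y₂<y₃
          ∷ inject₁<fromℕ y₃ ∷ [-])
          (σy₁′<v ∷ s≤s v≤σy₁ ∷ s≤s σy₁<σy₂ ∷ s≤s σy₂<σy₃ ∷ [-]) values
    where
    ι : Vec (Fin (suc k)) 5
    ι = inject₁ y₁ ∷ inject₁ y₁′ ∷ inject₁ y₂ ∷ inject₁ y₃ ∷ fromℕ k ∷ []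
    w : Vec ℕ 5
    w = toℕ (lookup σ y₁′) ∷ toℕ v ∷
        suc (toℕ (lookup σ y₁)) ∷ suc (toℕ (lookup σ y₂)) ∷ suc (toℕ (lookup σ y₃)) ∷ []
    v≤σy₂ : toℕ v ℕ.≤ toℕ (lookup σ y₂)
    v≤σy₂ = ℕ.≤-trans v≤σy₁ (ℕ.<⇒≤ σy₁<σy₂)
    values : ∀ a → toℕ (lookup π (lookup ι a)) ≡ lookup w (lookup p31452 a)
    values 0F = extend-value-above y₁ refl v≤σy₁
    values 1F = extend-value-below y₁′ σy₁′<v
    values 2F = extend-value-above y₂ refl v≤σy₂
    values 3F = extend-value-above y₃ refl (ℕ.≤-trans v≤σy₂ (ℕ.<⇒≤ σy₂<σy₃))
    values 4F = extend-value-last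

  avoids31452-extend : Avoids p31452 σ → k ℕ.≤ suc (suc (toℕ v)) → Avoids p31452 π
  avoids31452-extend avoid k≤v+2 (i₀ ∷ i₁ ∷ i₂ ∷ i₃ ∷ i₄ ∷ [] , occ@(_ , orderIso)) with view i₄
  ... | ‵inject₁ x₄ = avoid (occurs-extend⁻ p31452 σ v (i₀ ∷ i₁ ∷ i₂ ∷ i₃ ∷ inject₁ x₄ ∷ []) occ
                               (Fin.toℕ-inject₁-≢ x₄))
  ... | ‵fromℕ = ℕ.1+n≰n (ℕ.≤-trans (ℕ.≤-trans v+3≤π₃ (ℕ.≤-pred (toℕ<n (lookup π i₃)))) k≤v+2)
    where
    open ℕ.≤-Reasoning
    v+3≤π₃ : suc (suc (suc (toℕ v))) ℕ.≤ toℕ (lookup π i₃)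
    v+3≤π₃ = begin
      3 + toℕ v                      ≡⟨ cong (3 +_) extend-value-last ⟨
      3 + toℕ (lookup π (fromℕ k))   ≤⟨ s≤s (s≤s (proj₁ (orderIso 4F 0F) (s≤s (s≤s z≤n)))) ⟩
      2 + toℕ (lookup π i₀)          ≤⟨ s≤s (proj₁ (orderIso 0F 2F) (s≤s (s≤s (s≤s z≤n)))) ⟩
      1 + toℕ (lookup π i₂)          ≤⟨ proj₁ (orderIso 2F 3F) (s≤s (s≤s (s≤s (s≤s z≤n)))) ⟩
      toℕ (lookup π i₃)              ∎

module _ {k} {σ : Word k} {v : Fin (suc k)} (σ-inj : IsPerm σ) where

  activeSite⇒¬ascentBottom : ActiveSite σ v → ¬ AscentBottom σ (toℕ v)
  activeSite⇒¬ascentBottom site (a , a′ , σa≡v , a′≡a+1 , σa<σa′) =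
    clash (activeSite-low site room)
    where
    room : suc (suc (toℕ v)) ℕ.≤ k
    room = ℕ.≤-trans (s≤s (subst (ℕ._< toℕ (lookup σ a′)) σa≡v σa<σa′)) (toℕ<n (lookup σ a′))
    clash : DescentTopBeforeSucc σ (toℕ v) → ⊥
    clash (i , i′ , _ , σi≡v , _ , _ , i′≡i+1 , σi′<σi) with position-unique σ σ-inj σi≡v σa≡v
    ... | refl = Fin.<-asym σa<σa′
      (subst (λ x → lookup σ x < lookup σ a) (toℕ-injective (trans i′≡i+1 (sym a′≡a+1))) σi′<σi)

  activeSite⇒¬inversionAbove : ActiveSite σ v → ¬ InversionAbove σ (toℕ v)
  activeSite⇒¬inversionAbove site (x , y , x<y , σy<σx , v≤σy) = clash (activeSite-low site room)
    where
    v<σx : toℕ v ℕ.< toℕ (lookup σ x)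
    v<σx = ℕ.≤-<-trans v≤σy σy<σx
    room : suc (suc (toℕ v)) ℕ.≤ k
    room = ℕ.≤-trans (s≤s v<σx) (toℕ<n (lookup σ x))
    σx≡v+1 : toℕ (lookup σ x) ≡ suc (toℕ v)
    σx≡v+1 = ℕ.≤-antisym (ℕ.≤-pred (ℕ.≤-trans (toℕ<n (lookup σ x)) (activeSite-≤ site))) v<σx
    σy≡v : toℕ (lookup σ y) ≡ toℕ v
    σy≡v = ℕ.≤-antisym (ℕ.≤-pred (subst (toℕ (lookup σ y) ℕ.<_) σx≡v+1 σy<σx)) v≤σy
    clash : DescentTopBeforeSucc σ (toℕ v) → ⊥
    clash (i , _ , j , σi≡v , σj≡v+1 , i<j , _) = Fin.<-asym x<y
      (subst₂ _<_ (position-unique σ σ-inj σi≡v σy≡v) (position-unique σ σ-inj σj≡v+1 σx≡v+1) i<j)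

  module _ (noAscent : ¬ AscentBottom σ (toℕ v)) (noInversion : ¬ InversionAbove σ (toℕ v)) where

    private
      positionOf : ∀ t → t ℕ.< k → ∃ λ x → toℕ (lookup σ x) ≡ t
      positionOf t t<k with isPerm-surjective σ σ-inj (fromℕ< t<k)
      ... | x , σx≡t = x , trans (cong toℕ σx≡t) (toℕ-fromℕ< t<k)

    succ-lies-after : ∀ {x y t} → toℕ v ℕ.≤ t →
      toℕ (lookup σ x) ≡ t → toℕ (lookup σ y) ≡ suc t → x < y
    succ-lies-after {x} {y} {t} v≤t σx≡t σy≡t+1 with Fin.<-cmp x y
    ... | tri< x<y _ _ = x<y
    ... | tri≈ _ refl _ = ⊥-elim (ℕ.<-irrefl (trans (sym σx≡t) σy≡t+1) (ℕ.n<1+n t))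
    ... | tri> _ _ y<x = ⊥-elim (noInversion
      (y , x , y<x , subst₂ ℕ._<_ (sym σx≡t) (sym σy≡t+1) (ℕ.n<1+n t) ,
       subst (toℕ v ℕ.≤_) (sym σx≡t) v≤t))

    next-is-smaller : ∀ {x y} → toℕ (lookup σ x) ≡ toℕ v → x < y →
      Σ (Fin k) λ x′ → toℕ x′ ≡ suc (toℕ x) × lookup σ x′ < lookup σ x
    next-is-smaller {x} {y} σx≡v x<y = descent (fromℕ< x+1<k) (toℕ-fromℕ< x+1<k)
      where
      x+1<k : suc (toℕ x) ℕ.< k
      x+1<k = ℕ.≤-<-trans x<y (toℕ<n y)
      descent : ∀ x′ → toℕ x′ ≡ suc (toℕ x) →
        Σ (Fin k) λ x′ → toℕ x′ ≡ suc (toℕ x) × lookup σ x′ < lookup σ x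
      descent x′ x′≡x+1 with Fin.<-cmp (lookup σ x′) (lookup σ x)
      ... | tri< σx′<σx _ _ = x′ , x′≡x+1 , σx′<σx
      ... | tri≈ _ σx′≡σx _ = ⊥-elim
        (ℕ.<-irrefl (cong toℕ (sym (σ-inj _ _ σx′≡σx))) (ℕ.≤-reflexive (sym x′≡x+1)))
      ... | tri> _ _ σx<σx′ = ⊥-elim (noAscent (x , x′ , σx≡v , x′≡x+1 , σx<σx′))

    room⇒descentTopBeforeSucc : suc (suc (toℕ v)) ℕ.≤ k → DescentTopBeforeSucc σ (toℕ v)
    room⇒descentTopBeforeSucc room
      with positionOf (toℕ v) (ℕ.≤-trans (ℕ.n≤1+n _) room) | positionOf (suc (toℕ v)) room
    ... | y₁ , σy₁≡v | y₂ , σy₂≡v+1 with succ-lies-after ℕ.≤-refl σy₁≡v σy₂≡v+1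
    ... | y₁<y₂ with next-is-smaller σy₁≡v y₁<y₂
    ... | y₁′ , y₁′≡y₁+1 , σy₁′<σy₁ =
      y₁ , y₁′ , y₂ , σy₁≡v , σy₂≡v+1 , y₁<y₂ , y₁′≡y₁+1 , σy₁′<σy₁

    room⇒contains31452-extend : suc (suc (suc (toℕ v))) ℕ.≤ k → Contains p31452 (extend σ v)
    room⇒contains31452-extend room
      with room⇒descentTopBeforeSucc (ℕ.≤-trans (ℕ.n≤1+n _) room) | positionOf (suc (suc (toℕ v))) room
    ... | y₁ , y₁′ , y₂ , σy₁≡v , σy₂≡v+1 , y₁<y₂ , y₁′≡y₁+1 , σy₁′<σy₁ | y₃ , σy₃≡v+2 =
      contains31452 σ v (ℕ.≤-reflexive (sym y₁′≡y₁+1)) y₁′<y₂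
        (succ-lies-after (ℕ.n≤1+n _) σy₂≡v+1 σy₃≡v+2)
        σy₁′<v (ℕ.≤-reflexive (sym σy₁≡v))
        (subst₂ ℕ._<_ (sym σy₁≡v) (sym σy₂≡v+1) (ℕ.n<1+n _))
        (subst₂ ℕ._<_ (sym σy₂≡v+1) (sym σy₃≡v+2) (ℕ.n<1+n _))
      where
      σy₁′<v : toℕ (lookup σ y₁′) ℕ.< toℕ v
      σy₁′<v = subst (toℕ (lookup σ y₁′) ℕ.<_) σy₁≡v σy₁′<σy₁
      y₁′<y₂ : y₁′ < y₂
      y₁′<y₂ = ℕ.≤∧≢⇒< (subst (ℕ._≤ toℕ y₂) (sym y₁′≡y₁+1) y₁<y₂) λ y₁′≡y₂ →
        ℕ.<⇒≢ (ℕ.<-trans σy₁′<v (subst (toℕ v ℕ.<_) (sym σy₂≡v+1) (ℕ.n<1+n _)))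
              (cong (toℕ ∘ lookup σ) (toℕ-injective y₁′≡y₂))

    conditions⇒activeSite : Avoids p31452 (extend σ v) → ActiveSite σ v
    conditions⇒activeSite avoid with ℕ.<-cmp (suc (suc (toℕ v))) k
    ... | tri< v+3≤k _ _ = ⊥-elim (avoid (room⇒contains31452-extend v+3≤k))
    ... | tri≈ _ v+2≡k _ = third v+2≡k (room⇒descentTopBeforeSucc (ℕ.≤-reflexive v+2≡k))
    ... | tri> _ _ k<v+2 with ℕ.<-cmp (toℕ v) k
    ...   | tri≈ _ v≡k _ = top v≡k
    ...   | tri< v<k _ _ = second (ℕ.≤-antisym v<k (ℕ.≤-pred k<v+2))
    ...   | tri> _ _ k<v = ⊥-elim (ℕ.<-irrefl refl (ℕ.<-≤-trans k<v (ℕ.≤-pred (toℕ<n v))))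

module _ {k} {σ : Word k} {v : Fin (suc k)} where

  good-extend⁻ : Good (extend σ v) → Good σ × ActiveSite σ v
  good-extend⁻ (π-inj , fishburn , avoid321 , avoid31452) =
    ( σ-inj , isFishburn-extend⁻ σ v fishburn
    , avoids-extend⁻ p321 σ v avoid321 , avoids-extend⁻ p31452 σ v avoid31452 ) ,
    conditions⇒activeSite σ-inj
      (λ ascent → ascentBottom⇒¬isFishburn σ v ascent fishburn)
      (λ inversion → avoid321 (inversionAbove⇒contains321 σ v inversion))
      avoid31452
    where
    σ-inj : IsPerm σ
    σ-inj = isPerm-extend⁻ σ v π-inj

  good-extend : Good σ × ActiveSite σ v → Good (extend σ v)
  good-extend ((σ-inj , fishburn , avoid321 , avoid31452) , site) =
    isPerm-extend σ v σ-inj ,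
    isFishburn-extend σ v fishburn (activeSite⇒¬ascentBottom σ-inj site) ,
    avoids321-extend σ v avoid321 (activeSite⇒¬inversionAbove σ-inj site) ,
    avoids31452-extend σ v avoid31452 (activeSite-≤ site)

-- The generating tree

optional : ∀ {P A : Set} → Dec P → A → List A
optional (yes _) a = a ∷ []
optional (no _)  a = []

module _ {P A : Set} where

  ∈-optional⁻ : ∀ (d : Dec P) (a : A) {x} → x ∈ optional d a → P × x ≡ a
  ∈-optional⁻ (yes p) a (here refl) = p , refl

  ∈-optional⁺ : ∀ (d : Dec P) (a : A) → P → a ∈ optional d a
  ∈-optional⁺ (yes _) a _ = here refl
  ∈-optional⁺ (no ¬p) a p = ⊥-elim (¬p p)

  unique-optional : ∀ (d : Dec P) (a : A) → Unique (optional d a)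
  unique-optional (yes _) a = [] ∷ []
  unique-optional (no _)  a = []

unique-concatMap : ∀ {A B : Set} (f : A → List B) → (∀ x → Unique (f x)) →
  (∀ {x y z} → z ∈ f x → z ∈ f y → x ≡ y) → ∀ {xs} → Unique xs → Unique (concatMap f xs)
unique-concatMap f unique-f disjoint {[]}     []                 = []
unique-concatMap f unique-f disjoint {x ∷ xs} (x∉xs ∷ unique-xs) =
  Unique.++⁺ (unique-f x) (unique-concatMap f unique-f disjoint unique-xs) λ (z∈fx , z∈rest) →
    let y , y∈xs , z∈fy = find (∈-concatMap⁻ f z∈rest)
    in  All.lookup x∉xs y∈xs (disjoint z∈fx z∈fy)

descentTopBeforeSucc? : ∀ {k} (σ : Word k) t → Dec (DescentTopBeforeSucc σ t)
descentTopBeforeSucc? σ t = any? λ i → any? λ i′ → any? λ j →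
  toℕ (lookup σ i) ℕ.≟ t ×-dec toℕ (lookup σ j) ℕ.≟ suc t ×-dec i Fin.<? j ×-dec
  toℕ i′ ℕ.≟ suc (toℕ i) ×-dec lookup σ i′ Fin.<? lookup σ i

topSite : ∀ m → Fin (suc (suc m))
topSite m = fromℕ (suc m)

secondSite : ∀ m → Fin (suc (suc m))
secondSite m = inject₁ (fromℕ m)

thirdSite : ∀ r → Fin (suc (suc (suc r)))
thirdSite r = inject₁ (inject₁ (fromℕ r))

toℕ-secondSite : ∀ m → toℕ (secondSite m) ≡ m
toℕ-secondSite m = trans (toℕ-inject₁ (fromℕ m)) (toℕ-fromℕ m)

toℕ-thirdSite : ∀ r → toℕ (thirdSite r) ≡ r
toℕ-thirdSite r = trans (toℕ-inject₁ _) (toℕ-secondSite r)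

thirdSites : ∀ m → Word (suc m) → List (Fin (suc (suc m)))
thirdSites zero    σ = []
thirdSites (suc r) σ = optional (descentTopBeforeSucc? σ r) (thirdSite r)

activeSites : ∀ m → Word (suc m) → List (Fin (suc (suc m)))
activeSites m σ = topSite m ∷ secondSite m ∷ thirdSites m σ

∈-thirdSites⁻ : ∀ m (σ : Word (suc m)) {v} → v ∈ thirdSites m σ →
  suc (suc (toℕ v)) ≡ suc m × DescentTopBeforeSucc σ (toℕ v)
∈-thirdSites⁻ (suc r) σ v∈ with ∈-optional⁻ (descentTopBeforeSucc? σ r) (thirdSite r) v∈
... | low , refl =
  cong (2 +_) (toℕ-thirdSite r) , subst (DescentTopBeforeSucc σ) (sym (toℕ-thirdSite r)) low

∈-thirdSites⁺ : ∀ m (σ : Word (suc m)) {v} →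
  suc (suc (toℕ v)) ≡ suc m → DescentTopBeforeSucc σ (toℕ v) → v ∈ thirdSites m σ
∈-thirdSites⁺ (suc r) σ {v} v+2≡m+1 low
  with toℕ-injective {i = v} (trans (ℕ.suc-injective (ℕ.suc-injective v+2≡m+1)) (sym (toℕ-thirdSite r)))
... | refl = ∈-optional⁺ (descentTopBeforeSucc? σ r) (thirdSite r)
               (subst (DescentTopBeforeSucc σ) (toℕ-thirdSite r) low)

unique-thirdSites : ∀ m (σ : Word (suc m)) → Unique (thirdSites m σ)
unique-thirdSites zero    σ = []
unique-thirdSites (suc r) σ = unique-optional (descentTopBeforeSucc? σ r) (thirdSite r)

module _ {m} {σ : Word (suc m)} where

  ∈-activeSites⁻ : ∀ {v} → v ∈ activeSites m σ → ActiveSite σ v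
  ∈-activeSites⁻ (here refl)         = top (toℕ-fromℕ (suc m))
  ∈-activeSites⁻ (there (here refl)) = second (cong suc (toℕ-secondSite m))
  ∈-activeSites⁻ (there (there v∈))  = let v+2≡m+1 , low = ∈-thirdSites⁻ m σ v∈ in third v+2≡m+1 low

  ∈-activeSites⁺ : ∀ {v} → ActiveSite σ v → v ∈ activeSites m σ
  ∈-activeSites⁺ (top v≡m+1) =
    here (toℕ-injective (trans v≡m+1 (sym (toℕ-fromℕ (suc m)))))
  ∈-activeSites⁺ (second v+1≡m+1) =
    there (here (toℕ-injective (trans (ℕ.suc-injective v+1≡m+1) (sym (toℕ-secondSite m)))))
  ∈-activeSites⁺ (third v+2≡m+1 low) = there (there (∈-thirdSites⁺ m σ v+2≡m+1 low))

  unique-activeSites : Unique (activeSites m σ)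
  unique-activeSites =
    (top≢second ∷ All.tabulate (top≢third ∘ ∈-thirdSites⁻ m σ)) ∷
    All.tabulate (second≢third ∘ ∈-thirdSites⁻ m σ) ∷
    unique-thirdSites m σ
    where
    top≢second : topSite m ≢ secondSite m
    top≢second eq =
      ℕ.1+n≢n (trans (sym (toℕ-fromℕ (suc m))) (trans (cong toℕ eq) (toℕ-secondSite m)))
    top≢third : ∀ {w} → suc (suc (toℕ w)) ≡ suc m × DescentTopBeforeSucc σ (toℕ w) → topSite m ≢ w
    top≢third {w} (w+2≡m+1 , _) eq =
      ℕ.m≢1+n+m (toℕ w) (sym (trans w+2≡m+1 (trans (sym (toℕ-fromℕ (suc m))) (cong toℕ eq))))
    second≢third : ∀ {w} → suc (suc (toℕ w)) ≡ suc m × DescentTopBeforeSucc σ (toℕ w) →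
                   secondSite m ≢ w
    second≢third {w} (w+2≡m+1 , _) eq =
      ℕ.1+n≢n (trans (ℕ.suc-injective w+2≡m+1) (trans (sym (toℕ-secondSite m)) (cong toℕ eq)))

children : ∀ m → Word (suc m) → List (Word (suc (suc m)))
children m σ = List.map (extend σ) (activeSites m σ)

unique-children : ∀ m σ → Unique (children m σ)
unique-children m σ = Unique.map⁺ (proj₂ ∘ extend-injective) unique-activeSites

children-disjoint : ∀ m {σ σ′ π} → π ∈ children m σ → π ∈ children m σ′ → σ ≡ σ′
children-disjoint m π∈ π∈′ with ∈-map⁻ (extend _) π∈ | ∈-map⁻ (extend _) π∈′
... | _ , _ , refl | _ , _ , eq = proj₁ (extend-injective eq)

goodPermutations : ∀ m → List (Word (suc m))
goodPermutations zero    = (zero ∷ []) ∷ []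
goodPermutations (suc m) = concatMap (children m) (goodPermutations m)

unique-goodPermutations : ∀ m → Unique (goodPermutations m)
unique-goodPermutations zero    = [] ∷ []
unique-goodPermutations (suc m) =
  unique-concatMap (children m) (unique-children m) (children-disjoint m) (unique-goodPermutations m)

good-singleton : Good (zero ∷ [])
good-singleton =
  (λ { zero zero _ → refl }) ,
  (λ { (zero , zero , zero , () , _) }) ,
  (λ { (zero ∷ zero ∷ _ , increasing , _) → ℕ.<-irrefl refl (increasing 0F 1F ℕ.≤-refl) }) ,
  (λ { (zero ∷ zero ∷ _ , increasing , _) → ℕ.<-irrefl refl (increasing 0F 1F ℕ.≤-refl) })

∈-goodPermutations⇔ : ∀ m (π : Word (suc m)) → π ∈ goodPermutations m ⇔ Good π
∈-goodPermutations⇔ m π = mk⇔ (sound m π) (complete m π)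
  where
  sound : ∀ m (π : Word (suc m)) → π ∈ goodPermutations m → Good π
  sound zero    π (here refl) = good-singleton
  sound (suc m) π π∈ with find (∈-concatMap⁻ (children m) π∈)
  ... | σ , σ∈ , π∈children with ∈-map⁻ (extend σ) π∈children
  ... | v , v∈ , refl = good-extend (sound m σ σ∈ , ∈-activeSites⁻ v∈)
  complete : ∀ m (π : Word (suc m)) → Good π → π ∈ goodPermutations m
  complete zero    (zero ∷ []) _    = here refl
  complete (suc m) π           good with extend-surjective π (proj₁ good)
  ... | σ , σ↦π with good-extend⁻ (subst Good (sym σ↦π) good)
  ... | good-σ , site = subst (_∈ goodPermutations (suc m)) σ↦π (∈-concatMap⁺ (children m)
        (lose (complete m σ good-σ) (∈-map⁺ (extend σ) (∈-activeSites⁺ site))))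

-- Counting

indicator : ∀ {P : Set} → Dec P → ℕ
indicator (yes _) = 1
indicator (no _)  = 0

indicator-yes : ∀ {P : Set} (d : Dec P) → P → indicator d ≡ 1
indicator-yes (yes _) _ = refl
indicator-yes (no ¬p) p = ⊥-elim (¬p p)

indicator-no : ∀ {P : Set} (d : Dec P) → ¬ P → indicator d ≡ 0
indicator-no (yes p) ¬p = ⊥-elim (¬p p)
indicator-no (no _)  _  = refl

indicator-complement : ∀ {P Q : Set} (p? : Dec P) (q? : Dec Q) → (P → ¬ Q) → (¬ Q → P) →
  indicator p? + indicator q? ≡ 1
indicator-complement (yes p) (yes q) P⇒¬Q _    = ⊥-elim (P⇒¬Q p q)
indicator-complement (yes _) (no _)  _    _    = refl
indicator-complement (no _)  (yes _) _    _    = refl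
indicator-complement (no ¬p) (no ¬q) _    ¬Q⇒P = ⊥-elim (¬p (¬Q⇒P ¬q))

length-optional : ∀ {P A : Set} (d : Dec P) (a : A) → length (optional d a) ≡ indicator d
length-optional (yes _) a = refl
length-optional (no _)  a = refl

total : ∀ {A : Set} → (A → ℕ) → List A → ℕ
total f xs = sum (List.map f xs)

total-++ : ∀ {A : Set} (f : A → ℕ) xs ys → total f (xs ++ ys) ≡ total f xs + total f ys
total-++ f xs ys = trans (cong sum (map-++ f xs ys)) (sum-++ (List.map f xs) _)

total-constant : ∀ {A : Set} (f : A → ℕ) c xs → (∀ {x} → x ∈ xs → f x ≡ c) →
  total f xs ≡ length xs * c
total-constant f c []       _   = refl
total-constant f c (x ∷ xs) f≡c = cong₂ _+_ (f≡c (here refl)) (total-constant f c xs (f≡c ∘ there))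

EndsWithMax : ∀ {m} → Word (suc m) → Set
EndsWithMax {m} σ = toℕ (lookup σ (fromℕ m)) ≡ m

endsWithMax : ∀ {m} → Word (suc m) → ℕ
endsWithMax {m} σ = indicator (toℕ (lookup σ (fromℕ m)) ℕ.≟ m)

thirdSiteCount : ∀ {m} → Word (suc m) → ℕ
thirdSiteCount {m} σ = length (thirdSites m σ)

thirdSiteCount-extend : ∀ {m} (σ : Word (suc m)) v →
  thirdSiteCount (extend σ v) ≡ indicator (descentTopBeforeSucc? (extend σ v) m)
thirdSiteCount-extend {m} σ v =
  length-optional (descentTopBeforeSucc? (extend σ v) m) (thirdSite m)

descentTopBeforeSucc-extend : ∀ {k} (σ : Word k) v → DescentTopBeforeSucc σ (toℕ v) →
  DescentTopBeforeSucc (extend σ v) (suc (toℕ v))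
descentTopBeforeSucc-extend σ v (i , i′ , j , σi≡v , σj≡v+1 , i<j , i′≡i+1 , σi′<σi) =
  inject₁ i , inject₁ i′ , inject₁ j ,
  extend-value-above σ v i σi≡v ℕ.≤-refl ,
  extend-value-above σ v j σj≡v+1 (ℕ.n≤1+n _) ,
  inject₁-mono-< i<j ,
  trans (toℕ-inject₁ i′) (trans i′≡i+1 (cong suc (sym (toℕ-inject₁ i)))) ,
  extend-mono-< σ v i′ i σi′<σi

module _ {m} (σ : Word (suc m)) where
  private
    π : Word (suc (suc m))
    π = extend σ (topSite m)

    value-top : ∀ x → toℕ (lookup π (inject₁ x)) ≡ toℕ (lookup σ x)
    value-top x = extend-value-below σ (topSite m) x
      (subst (toℕ (lookup σ x) ℕ.<_) (sym (toℕ-fromℕ (suc m))) (toℕ<n _))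

    last-top : toℕ (lookup π (fromℕ (suc m))) ≡ suc m
    last-top = trans (extend-value-last σ (topSite m)) (toℕ-fromℕ (suc m))

  -- The old maximum m is followed either by the new last entry m + 1 or by a smaller entry.
  topChild-descentTopBeforeSucc⁻ : IsPerm σ → DescentTopBeforeSucc π m → ¬ EndsWithMax σ
  topChild-descentTopBeforeSucc⁻ σ-inj (i , i′ , j , πi≡m , _ , _ , i′≡i+1 , πi′<πi) σ-ends
    with view i
  ... | ‵fromℕ     = ℕ.1+n≢n (trans (sym last-top) πi≡m)
  ... | ‵inject₁ x = ℕ.<-asym πi′<πi (subst₂ ℕ._<_ (sym πi≡m) (sym πi′≡m+1) (ℕ.n<1+n m))
    where
    x≡last : x ≡ fromℕ m
    x≡last = position-unique σ σ-inj (trans (sym (value-top x)) πi≡m) σ-ends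
    i′≡last : i′ ≡ fromℕ (suc m)
    i′≡last = toℕ-injective (trans i′≡i+1 (cong suc (trans (toℕ-inject₁ x) (cong toℕ x≡last))))
    πi′≡m+1 : toℕ (lookup π i′) ≡ suc m
    πi′≡m+1 = trans (cong (toℕ ∘ lookup π) i′≡last) last-top

  topChild-descentTopBeforeSucc : IsPerm σ → ¬ EndsWithMax σ → DescentTopBeforeSucc π m
  topChild-descentTopBeforeSucc σ-inj ¬ends with isPerm-surjective σ σ-inj (fromℕ m)
  ... | p , σp≡last =
    inject₁ p , inject₁ p′ , fromℕ (suc m) ,
    trans (value-top p) σp≡m ,
    last-top ,
    inject₁<fromℕ p ,
    trans (toℕ-inject₁ p′) (trans (toℕ-fromℕ< (s≤s p<m)) (cong suc (sym (toℕ-inject₁ p)))) ,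
    subst₂ ℕ._<_ (sym (value-top p′)) (sym (trans (value-top p) σp≡m)) σp′<m
    where
    σp≡m : toℕ (lookup σ p) ≡ m
    σp≡m = trans (cong toℕ σp≡last) (toℕ-fromℕ m)
    p<m : toℕ p ℕ.< m
    p<m = ℕ.≤∧≢⇒< (ℕ.≤-pred (toℕ<n p)) λ p≡m → ¬ends
      (subst (λ x → toℕ (lookup σ x) ≡ m) (toℕ-injective (trans p≡m (sym (toℕ-fromℕ m)))) σp≡m)
    p′ : Fin (suc m)
    p′ = fromℕ< (s≤s p<m)
    σp′<m : toℕ (lookup σ p′) ℕ.< m
    σp′<m = ℕ.≤∧≢⇒< (ℕ.≤-pred (toℕ<n (lookup σ p′))) λ σp′≡m →
      ℕ.<-irrefl (cong toℕ (position-unique σ σ-inj σp≡m σp′≡m))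
        (subst (toℕ p ℕ.<_) (sym (toℕ-fromℕ< (s≤s p<m))) (ℕ.n<1+n _))

  secondChild-¬descentTopBeforeSucc : ¬ DescentTopBeforeSucc (extend σ (secondSite m)) m
  secondChild-¬descentTopBeforeSucc (i , _ , j , πi≡m , _ , i<j , _) with view i
  ... | ‵fromℕ = ℕ.<-irrefl refl
    (ℕ.<-≤-trans (subst (ℕ._< toℕ j) (toℕ-fromℕ (suc m)) i<j) (ℕ.≤-pred (toℕ<n j)))
  ... | ‵inject₁ x = punchInᵢ≢i (secondSite m) (lookup σ x) (toℕ-injective
    (trans (sym (extend-value-inject₁ σ (secondSite m) x)) (trans πi≡m (sym (toℕ-secondSite m)))))

  length-children : length (children m σ) ≡ 2 + thirdSiteCount σ
  length-children = cong (2 +_) (length-map (extend σ) (thirdSites m σ))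

  total-endsWithMax-children : total endsWithMax (children m σ) ≡ 1
  total-endsWithMax-children = cong₂ _+_ top-ends (cong₂ _+_ second-ends third-ends)
    where
    top-ends : endsWithMax (extend σ (topSite m)) ≡ 1
    top-ends = indicator-yes (_ ℕ.≟ suc m) last-top
    second-ends : endsWithMax (extend σ (secondSite m)) ≡ 0
    second-ends = indicator-no (_ ℕ.≟ suc m) λ ends → ℕ.1+n≢n
      (trans (sym ends) (trans (extend-value-last σ (secondSite m)) (toℕ-secondSite m)))
    third-end : ∀ {π} → ∃ (λ v → v ∈ thirdSites m σ × π ≡ extend σ v) → endsWithMax π ≡ 0
    third-end (v , v∈ , refl) = indicator-no (_ ℕ.≟ suc m) λ ends → ℕ.m≢1+n+m (toℕ v)
      (trans (sym (extend-value-last σ v)) (trans ends (sym (proj₁ (∈-thirdSites⁻ m σ v∈)))))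
    third-ends : total endsWithMax (List.map (extend σ) (thirdSites m σ)) ≡ 0
    third-ends = trans (total-constant endsWithMax 0 _ (third-end ∘ ∈-map⁻ (extend σ)))
                       (ℕ.*-zeroʳ (length (List.map (extend σ) (thirdSites m σ))))

  total-thirdSiteCount-children : IsPerm σ →
    total thirdSiteCount (children m σ) + endsWithMax σ ≡ 1 + thirdSiteCount σ
  total-thirdSiteCount-children σ-inj = begin
    (topCount + (secondCount + thirdsCount)) + endsWithMax σ
      ≡⟨ rearrange topCount secondCount thirdsCount (endsWithMax σ) ⟩
    (topCount + endsWithMax σ) + secondCount + thirdsCount
      ≡⟨ cong₂ (λ a b → a + b + thirdsCount) top-complement second-count ⟩
    1 + 0 + thirdsCount
      ≡⟨ cong suc thirds-count ⟩
    1 + thirdSiteCount σ ∎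
    where
    open ≡-Reasoning
    thirdChildren : List (Word (suc (suc m)))
    thirdChildren = List.map (extend σ) (thirdSites m σ)
    topCount secondCount thirdsCount : ℕ
    topCount = thirdSiteCount (extend σ (topSite m))
    secondCount = thirdSiteCount (extend σ (secondSite m))
    thirdsCount = total thirdSiteCount thirdChildren
    rearrange : ∀ a b c d → (a + (b + c)) + d ≡ (a + d) + b + c
    rearrange = solve-∀
    top-complement : topCount + endsWithMax σ ≡ 1
    top-complement = trans (cong (_+ endsWithMax σ) (thirdSiteCount-extend σ (topSite m)))
      (indicator-complement (descentTopBeforeSucc? π m) (_ ℕ.≟ m)
        (topChild-descentTopBeforeSucc⁻ σ-inj) (topChild-descentTopBeforeSucc σ-inj))
    second-count : secondCount ≡ 0
    second-count = trans (thirdSiteCount-extend σ (secondSite m))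
      (indicator-no (descentTopBeforeSucc? (extend σ (secondSite m)) m)
        secondChild-¬descentTopBeforeSucc)
    third-one : ∀ {π} → ∃ (λ v → v ∈ thirdSites m σ × π ≡ extend σ v) → thirdSiteCount π ≡ 1
    third-one (v , v∈ , refl) with ∈-thirdSites⁻ m σ v∈
    ... | v+2≡m+1 , low = trans (thirdSiteCount-extend σ v)
      (indicator-yes (descentTopBeforeSucc? (extend σ v) m)
        (subst (DescentTopBeforeSucc (extend σ v)) (ℕ.suc-injective v+2≡m+1)
          (descentTopBeforeSucc-extend σ v low)))
    thirds-count : thirdsCount ≡ thirdSiteCount σ
    thirds-count = begin
      thirdsCount                ≡⟨ total-constant thirdSiteCount 1 _ (third-one ∘ ∈-map⁻ (extend σ)) ⟩
      length thirdChildren * 1   ≡⟨ ℕ.*-identityʳ _ ⟩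
      length thirdChildren       ≡⟨ length-map (extend σ) (thirdSites m σ) ⟩
      thirdSiteCount σ           ∎

module _ (m : ℕ) where
  private
    T E : List (Word (suc m)) → ℕ
    T = total thirdSiteCount
    E = total endsWithMax
    T′ E′ : List (Word (suc (suc m))) → ℕ
    T′ = total thirdSiteCount
    E′ = total endsWithMax
    next : List (Word (suc m)) → List (Word (suc (suc m)))
    next = concatMap (children m)

  length-concatMap-children : ∀ xs → length (next xs) ≡ 2 * length xs + T xs
  length-concatMap-children []       = refl
  length-concatMap-children (σ ∷ xs) = begin
    length (children m σ ++ next xs)                 ≡⟨ length-++ (children m σ) ⟩
    length (children m σ) + length (next xs)         ≡⟨ cong₂ _+_ (length-children σ)
                                                                  (length-concatMap-children xs) ⟩
    (2 + thirdSiteCount σ) + (2 * length xs + T xs)  ≡⟨ rearrange (thirdSiteCount σ) (length xs) _ ⟩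
    2 * suc (length xs) + (thirdSiteCount σ + T xs)  ∎
    where
    open ≡-Reasoning
    rearrange : ∀ a b c → (2 + a) + (2 * b + c) ≡ 2 * suc b + (a + c)
    rearrange = solve-∀

  total-endsWithMax-concatMap-children : ∀ xs → E′ (next xs) ≡ length xs
  total-endsWithMax-concatMap-children []       = refl
  total-endsWithMax-concatMap-children (σ ∷ xs) = trans (total-++ endsWithMax (children m σ) _)
    (cong₂ _+_ (total-endsWithMax-children σ) (total-endsWithMax-concatMap-children xs))

  total-thirdSiteCount-concatMap-children : ∀ xs → All IsPerm xs →
    T′ (next xs) + E xs ≡ length xs + T xs
  total-thirdSiteCount-concatMap-children []       []               = refl
  total-thirdSiteCount-concatMap-children (σ ∷ xs) (σ-inj ∷ xs-inj) = begin
    T′ (children m σ ++ next xs) + (endsWithMax σ + E xs)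
      ≡⟨ cong (_+ (endsWithMax σ + E xs)) (total-++ thirdSiteCount (children m σ) _) ⟩
    (T′ (children m σ) + T′ (next xs)) + (endsWithMax σ + E xs)
      ≡⟨ rearrange (T′ (children m σ)) _ (endsWithMax σ) _ ⟩
    (T′ (children m σ) + endsWithMax σ) + (T′ (next xs) + E xs)
      ≡⟨ cong₂ _+_ (total-thirdSiteCount-children σ σ-inj)
                   (total-thirdSiteCount-concatMap-children xs xs-inj) ⟩
    (1 + thirdSiteCount σ) + (length xs + T xs)
      ≡⟨ cong suc (rearrange′ (thirdSiteCount σ) (length xs) _) ⟩
    suc (length xs) + (thirdSiteCount σ + T xs) ∎
    where
    open ≡-Reasoning
    rearrange : ∀ a b c d → (a + b) + (c + d) ≡ (a + c) + (b + d)
    rearrange = solve-∀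
    rearrange′ : ∀ a b c → a + (b + c) ≡ b + (a + c)
    rearrange′ = solve-∀

count : ℕ → ℕ
count m = length (goodPermutations m)

thirdSiteTotal : ℕ → ℕ
thirdSiteTotal m = total thirdSiteCount (goodPermutations m)

endsWithMaxTotal : ℕ → ℕ
endsWithMaxTotal m = total endsWithMax (goodPermutations m)

count-suc : ∀ m → count (suc m) ≡ 2 * count m + thirdSiteTotal m
count-suc m = length-concatMap-children m (goodPermutations m)

endsWithMaxTotal-suc : ∀ m → endsWithMaxTotal (suc m) ≡ count m
endsWithMaxTotal-suc m = total-endsWithMax-concatMap-children m (goodPermutations m)

thirdSiteTotal-suc : ∀ m → thirdSiteTotal (suc m) + endsWithMaxTotal m ≡ count m + thirdSiteTotal m
thirdSiteTotal-suc m = total-thirdSiteCount-concatMap-children m (goodPermutations m)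
  (All.tabulate (λ σ∈ → proj₁ (Equivalence.to (∈-goodPermutations⇔ m _) σ∈)))

suc-thirdSiteTotal≡endsWithMaxTotal : ∀ m → suc (thirdSiteTotal m) ≡ endsWithMaxTotal m
suc-thirdSiteTotal≡endsWithMaxTotal zero    = refl
suc-thirdSiteTotal≡endsWithMaxTotal (suc m) = ℕ.+-cancelʳ-≡ (thirdSiteTotal m) _ _ (begin
  suc (thirdSiteTotal (suc m)) + thirdSiteTotal m ≡⟨ ℕ.+-suc _ _ ⟨
  thirdSiteTotal (suc m) + suc (thirdSiteTotal m) ≡⟨ cong (thirdSiteTotal (suc m) +_)
                                                          (suc-thirdSiteTotal≡endsWithMaxTotal m) ⟩
  thirdSiteTotal (suc m) + endsWithMaxTotal m     ≡⟨ thirdSiteTotal-suc m ⟩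
  count m + thirdSiteTotal m                      ≡⟨ cong (_+ thirdSiteTotal m) (endsWithMaxTotal-suc m) ⟨
  endsWithMaxTotal (suc m) + thirdSiteTotal m     ∎)
  where open ≡-Reasoning

count-recurrence : ∀ m → count (2 + m) + 1 ≡ 2 * count (1 + m) + count m
count-recurrence m = begin
  count (2 + m) + 1                                ≡⟨ cong (_+ 1) (count-suc (suc m)) ⟩
  2 * count (1 + m) + thirdSiteTotal (1 + m) + 1   ≡⟨ ℕ.+-assoc (2 * count (1 + m)) _ 1 ⟩
  2 * count (1 + m) + (thirdSiteTotal (1 + m) + 1) ≡⟨ cong (2 * count (1 + m) +_) (ℕ.+-comm _ 1) ⟩
  2 * count (1 + m) + suc (thirdSiteTotal (1 + m)) ≡⟨ cong (2 * count (1 + m) +_) suc-T≡count ⟩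
  2 * count (1 + m) + count m                      ∎
  where
  open ≡-Reasoning
  suc-T≡count : suc (thirdSiteTotal (1 + m)) ≡ count m
  suc-T≡count = trans (suc-thirdSiteTotal≡endsWithMaxTotal (suc m)) (endsWithMaxTotal-suc m)

pell-sum-recurrence : ∀ m →
  pell (3 + m) + pell (2 + m) ≡ 2 * (pell (2 + m) + pell (1 + m)) + (pell (1 + m) + pell m)
pell-sum-recurrence m = identity (pell (suc m)) (pell m)
  where
  identity : ∀ x y → (2 * (2 * x + y) + x) + (2 * x + y) ≡ 2 * ((2 * x + y) + x) + (x + y)
  identity = solve-∀

twice-count : ∀ m → 2 * count m ≡ pell (suc m) + pell m + 1
twice-count zero          = refl
twice-count (suc zero)    = refl
twice-count (suc (suc m)) = ℕ.+-cancelʳ-≡ 2 _ _ (begin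
  2 * count (2 + m) + 2                 ≡⟨ ℕ.*-distribˡ-+ 2 (count (2 + m)) 1 ⟨
  2 * (count (2 + m) + 1)               ≡⟨ cong (2 *_) (count-recurrence m) ⟩
  2 * (2 * count (1 + m) + count m)     ≡⟨ ℕ.*-distribˡ-+ 2 (2 * count (1 + m)) (count m) ⟩
  2 * (2 * count (1 + m)) + 2 * count m ≡⟨ cong₂ (λ a b → 2 * a + b) (twice-count (suc m))
                                                                     (twice-count m) ⟩
  2 * (Q (1 + m) + 1) + (Q m + 1)       ≡⟨ rearrange (Q (1 + m)) (Q m) ⟩
  (2 * Q (1 + m) + Q m) + 1 + 2         ≡⟨ cong (λ q → q + 1 + 2) (pell-sum-recurrence m) ⟨
  Q (2 + m) + 1 + 2                     ∎)
  where
  open ≡-Reasoning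
  Q : ℕ → ℕ
  Q n = pell (suc n) + pell n
  rearrange : ∀ a b → 2 * (a + 1) + (b + 1) ≡ (2 * a + b) + 1 + 2
  rearrange = solve-∀

theorem4p4 : (m : ℕ) → ∃ λ (L : List (Word (suc m))) →
    Unique L × ((π : Word (suc m)) → (π ∈ L) ⇔ Good π) ×
    (2 * length L ≡ pell (suc m) + pell m + 1)
theorem4p4 m =
  goodPermutations m , unique-goodPermutations m , ∈-goodPermutations⇔ m , twice-count m
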